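{- Let $\gamma=\log_3(2)$. Every DNF with $m$ non-empty pairwise distinct terms has at least $m^{\gamma}$ models.
   Context: A literal is a variable $x$ or its negation $\neg x$; a term is a finite set of literals on pairwise distinct variables; a DNF is a finite set of terms over a finite set of variables $X$ (containing all variables occurring in the DNF). A model is an assignment $X\to\{0,1\}$ making all literals of at least one term true. -}

module Defs where

open import Data.Nat using (ℕ; zero; suc)
open import Data.Bool using (Bool; true; false; _∧_; _∨_; if_then_else_; not)
open import Data.Maybe using (Maybe; just; nothing)
open import Data.Vec using (Vec; []; _∷_)
open import Data.List using (List; []; _∷_; length; filterᵇ; concatMap)
open import Data.Bool.ListAction using (any)
open import Data.List.Relation.Unary.Unique.Propositional using (Unique)
open import Data.Vec.Relation.Unary.Any using (Any)
open import Data.Product using (_×_)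
open import Relation.Binary.PropositionalEquality using (_≢_)

-- A term (a finite set of literals on
-- pairwise distinct variables) is represented by its partial sign assignment:
-- entry i is  nothing  (variable i does not occur),  just true  (literal x_i)
-- or  just false  (literal ¬x_i).  This is a bijective encoding, so equality of
-- terms as sets of literals is propositional equality of these vectors.
Term : ℕ → Set
Term n = Vec (Maybe Bool) n

DNF : ℕ → Set
DNF n = List (Term n)

NonEmptyTerm : ∀ {n} → Term n → Set
NonEmptyTerm t = Any (λ x → x ≢ nothing) t

Assignment : ℕ → Set
Assignment n = Vec Bool n

litTrue : Maybe Bool → Bool → Bool
litTrue nothing  _ = true
litTrue (just s) b = if s then b else not b

termTrue : ∀ {n} → Term n → Assignment n → Bool
termTrue []       []       = true
termTrue (l ∷ t) (b ∷ a) = litTrue l b ∧ termTrue t a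

isModel : ∀ {n} → DNF n → Assignment n → Bool
isModel D a = any (λ t → termTrue t a) D

allAssignments : (n : ℕ) → List (Assignment n)
allAssignments zero    = [] ∷ []
allAssignments (suc n) = concatMap (λ a → (false ∷ a) ∷ (true ∷ a) ∷ []) (allAssignments n)

numModels : ∀ {n} → DNF n → ℕ
numModels {n} D = length (filterᵇ (isModel D) (allAssignments n))

module Submission where

-- A DNF with m distinct terms has at least m^γ models, γ = log₃ 2, stated as
-- m ^ p ≤ N ^ q whenever 3ᵖ ≤ 2^q.
--
-- The proof runs through the integer function F with F 0 = 0, F 1 = 1 and
-- F n = F ⌈n/2⌉ + 2 F ⌊n/2⌋ (so F (2ᵏ) = 3ᵏ).
--  * Counting: if distinct terms all imply a predicate with N satisfying
--    assignments, there are at most F N of them.  Induction on the number of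
--    variables splits the terms by their literal on the first variable and the
--    assignments by its value; the pieces recombine by the superadditivity
--    F u + 2 F v ≤ F (u + v) (v ≤ u).
--  * Growth: F is supermultiplicative, so F(N)ᴸ ≤ F(Nᴸ) ≤ 3ʲ with 2ʲ ≤ 2Nᴸ;
--    hence (F N ^ p)ᴸ ≤ 2^q (N ^ q)ᴸ for all L, and a power trick based on
--    Bernoulli's inequality gives F N ^ p ≤ N ^ q.

open import Defs
open import Data.Nat using (ℕ; _≤_; _<_; _^_)
open import Data.List using (length)
open import Data.List.Relation.Unary.All using (All)
open import Data.List.Relation.Unary.Unique.Propositional using (Unique)

open import Data.Nat
  using (zero; suc; _+_; _*_; z≤n; s≤s; z<s; ⌊_/2⌋; ⌈_/2⌉; NonZero; >-nonZero⁻¹; _≤?_)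
open import Data.Nat.Properties
open import Data.Nat.Induction using (<-rec)
open import Data.Nat.Tactic.RingSolver using (solve-∀)
open import Data.Bool using (Bool; true; false; T; if_then_else_)
open import Data.Bool.Properties using () renaming (_≟_ to _≟ᵇ_)
open import Data.Maybe using (Maybe; just; nothing)
open import Data.Maybe.Properties using (≡-dec)
open import Data.Vec using ([]; _∷_)
open import Data.List using (List; []; _∷_; filterᵇ; concatMap)
open import Data.List.Relation.Unary.All using ([]; _∷_; tabulate) renaming (map to all-map)
open import Data.List.Relation.Unary.AllPairs using ([]; _∷_)
open import Data.List.Relation.Unary.Any.Properties using (any⁺)
open import Data.List.Membership.Propositional using (lose)
open import Data.Product using (∃-syntax; _×_; _,_)
open import Data.Sum using (inj₁; inj₂)
open import Data.Unit using (tt)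
open import Data.Empty using (⊥-elim)
open import Relation.Nullary using (Dec; yes; no; does; contradiction)
open import Relation.Binary.PropositionalEquality
open import Function using (_∘_)

data Halving : ℕ → Set where
  even : ∀ a → Halving (a + a)
  odd  : ∀ a → Halving (suc (a + a))

halve : ∀ n → Halving n
halve zero = even 0
halve (suc n) with halve n
... | even a = odd a
... | odd a  = subst Halving (cong suc (+-suc a a)) (even (suc a))

halving-induction : (P : ℕ → Set) → P 0 → P 1 →
                    (∀ a → P a → P (a + a)) →
                    (∀ a → P a → P (suc a) → P (suc (a + a))) →
                    ∀ n → P n
halving-induction P p₀ p₁ even-step odd-step = <-rec P step
  where
  step : ∀ n → (∀ {m} → m < n → P m) → P n
  step n rec with halve n
  ... | even zero    = p₀
  ... | even (suc a) = even-step (suc a) (rec (m<m+n (suc a) z<s))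
  ... | odd zero     = p₁
  ... | odd (suc a)  = odd-step (suc a) (rec (s≤s (m≤m+n (suc a) (suc a))))
                                        (rec (s≤s (m<m+n (suc a) z<s)))

-- F N bounds the number of distinct terms all of whose models lie in a fixed
-- set of N assignments.  It is defined with fuel, since the recursion is not
-- structural; any fuel exceeding the argument gives the same value.
F-fuel : ℕ → ℕ → ℕ
F-fuel zero    _             = 0
F-fuel (suc k) zero          = 0
F-fuel (suc k) (suc zero)    = 1
F-fuel (suc k) (suc (suc n)) = F-fuel k (suc ⌈ n /2⌉) + 2 * F-fuel k (suc ⌊ n /2⌋)

F-fuel-stable : ∀ {k k′} n → n < k → n < k′ → F-fuel k n ≡ F-fuel k′ n
F-fuel-stable {suc k} {suc k′} zero          _ _ = refl
F-fuel-stable {suc k} {suc k′} (suc zero)    _ _ = refl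
F-fuel-stable {suc k} {suc k′} (suc (suc n)) (s≤s n<k) (s≤s n<k′) =
  cong₂ (λ x y → x + 2 * y)
        (F-fuel-stable (suc ⌈ n /2⌉) (shrink (⌈n/2⌉≤n n) n<k) (shrink (⌈n/2⌉≤n n) n<k′))
        (F-fuel-stable (suc ⌊ n /2⌋) (shrink (⌊n/2⌋≤n n) n<k) (shrink (⌊n/2⌋≤n n) n<k′))
  where
  shrink : ∀ {m j} → m ≤ n → suc (suc n) ≤ j → suc m < j
  shrink m≤n = ≤-trans (s≤s (s≤s m≤n))

F : ℕ → ℕ
F n = F-fuel (suc n) n

F-halves : ∀ n → F (2 + n) ≡ F (suc ⌈ n /2⌉) + 2 * F (suc ⌊ n /2⌋)
F-halves n = cong₂ (λ x y → x + 2 * y)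
  (F-fuel-stable (suc ⌈ n /2⌉) (s≤s (s≤s (⌈n/2⌉≤n n))) ≤-refl)
  (F-fuel-stable (suc ⌊ n /2⌋) (s≤s (s≤s (⌊n/2⌋≤n n))) ≤-refl)

⌊n+n/2⌋≡n : ∀ n → ⌊ n + n /2⌋ ≡ n
⌊n+n/2⌋≡n n = sym (n≡⌊n+n/2⌋ n)

⌈n+n/2⌉≡n : ∀ n → ⌈ n + n /2⌉ ≡ n
⌈n+n/2⌉≡n n = sym (n≡⌈n+n/2⌉ n)

F-even : ∀ a → F (a + a) ≡ 3 * F a
F-even zero    = refl
F-even (suc a) = begin
  F (suc a + suc a)                                   ≡⟨ cong (F ∘ suc) (+-suc a a) ⟩
  F (2 + (a + a))                                     ≡⟨ F-halves (a + a) ⟩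
  F (suc ⌈ a + a /2⌉) + 2 * F (suc ⌊ a + a /2⌋)       ≡⟨ cong₂ (λ x y → F (suc x) + 2 * F (suc y))
                                                              (⌈n+n/2⌉≡n a) (⌊n+n/2⌋≡n a) ⟩
  F (suc a) + 2 * F (suc a)                           ∎
  where open ≡-Reasoning

F-odd : ∀ a → F (suc (a + a)) ≡ F (suc a) + 2 * F a
F-odd zero    = refl
F-odd (suc a) = begin
  F (suc (suc a + suc a))                             ≡⟨ cong (F ∘ suc ∘ suc) (+-suc a a) ⟩
  F (2 + suc (a + a))                                 ≡⟨ F-halves (suc (a + a)) ⟩
  F (suc (suc ⌊ a + a /2⌋)) + 2 * F (suc ⌈ a + a /2⌉) ≡⟨ cong₂ (λ x y → F (suc (suc x)) + 2 * F (suc y))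
                                                              (⌊n+n/2⌋≡n a) (⌈n+n/2⌉≡n a) ⟩
  F (suc (suc a)) + 2 * F (suc a)                     ∎
  where open ≡-Reasoning

F-suc-mono : ∀ n → F n ≤ F (suc n)
F-suc-mono = halving-induction (λ n → F n ≤ F (suc n)) z≤n (s≤s z≤n) even-step odd-step
  where
  open ≤-Reasoning
  even-step : ∀ a → F a ≤ F (suc a) → F (a + a) ≤ F (suc (a + a))
  even-step a ih = begin
    F (a + a)             ≡⟨ F-even a ⟩
    F a + 2 * F a         ≤⟨ +-monoˡ-≤ (2 * F a) ih ⟩
    F (suc a) + 2 * F a   ≡⟨ F-odd a ⟨
    F (suc (a + a))       ∎
  odd-step : ∀ a → F a ≤ F (suc a) → F (suc a) ≤ F (suc (suc a)) →
             F (suc (a + a)) ≤ F (suc (suc (a + a)))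
  odd-step a ih _ = begin
    F (suc (a + a))             ≡⟨ F-odd a ⟩
    F (suc a) + 2 * F a         ≤⟨ +-monoʳ-≤ (F (suc a)) (*-monoʳ-≤ 2 ih) ⟩
    F (suc a) + 2 * F (suc a)   ≡⟨ F-even (suc a) ⟨
    F (suc a + suc a)           ≡⟨ cong (F ∘ suc) (+-suc a a) ⟩
    F (suc (suc (a + a)))       ∎

F-mono : ∀ {m n} → m ≤ n → F m ≤ F n
F-mono {n = zero}  z≤n = ≤-refl
F-mono {n = suc n} m≤1+n with m≤n⇒m<n∨m≡n m≤1+n
... | inj₁ (s≤s m≤n) = ≤-trans (F-mono m≤n) (F-suc-mono n)
... | inj₂ refl      = ≤-refl

shape-mono : ∀ {x x′ y y′} → x ≤ x′ → y ≤ y′ → x + 2 * y ≤ x′ + 2 * y′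
shape-mono x≤x′ y≤y′ = +-mono-≤ x≤x′ (*-monoʳ-≤ 2 y≤y′)

even≤even : ∀ {a b} → b + b ≤ a + a → b ≤ a
even≤even {a} {b} h = subst₂ _≤_ (⌊n+n/2⌋≡n b) (⌊n+n/2⌋≡n a) (⌊n/2⌋-mono h)

odd≤even : ∀ {a b} → suc (b + b) ≤ a + a → suc b ≤ a
odd≤even {a} {b} h = subst₂ _≤_ (cong suc (⌊n+n/2⌋≡n b)) (⌈n+n/2⌉≡n a) (⌈n/2⌉-mono h)

even≤odd : ∀ {a b} → b + b ≤ suc (a + a) → b ≤ a
even≤odd {a} {b} h = subst₂ _≤_ (⌊n+n/2⌋≡n b) (⌈n+n/2⌉≡n a) (⌊n/2⌋-mono h)

-- In each case
-- both sides are rewritten by the recurrence and the left side regrouped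
-- into two instances of the induction hypothesis at the halves.
Superadditive : ℕ → Set
Superadditive u = ∀ v → v ≤ u → F u + 2 * F v ≤ F (u + v)

superadditive-even : ∀ a → Superadditive a → Superadditive (a + a)
superadditive-even a ih v v≤u with halve v
... | even b = let b≤a = even≤even v≤u in begin
  F (a + a) + 2 * F (b + b)              ≡⟨ cong₂ (λ x y → x + 2 * y) (F-even a) (F-even b) ⟩
  3 * F a + 2 * (3 * F b)                ≡⟨ regroup₁ (F a) (F b) ⟩
  (F a + 2 * F b) + 2 * (F a + 2 * F b)  ≤⟨ shape-mono (ih b b≤a) (ih b b≤a) ⟩
  F (a + b) + 2 * F (a + b)              ≡⟨ F-even (a + b) ⟨
  F ((a + b) + (a + b))                  ≡⟨ cong F (interchange a b) ⟨
  F ((a + a) + (b + b))                  ∎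
  where
  open ≤-Reasoning
  regroup₁ : ∀ x y → 3 * x + 2 * (3 * y) ≡ (x + 2 * y) + 2 * (x + 2 * y)
  regroup₁ = solve-∀
  interchange : ∀ m n → (m + m) + (n + n) ≡ (m + n) + (m + n)
  interchange = solve-∀
... | odd b = let 1+b≤a = odd≤even v≤u in begin
  F (a + a) + 2 * F (suc (b + b))                ≡⟨ cong₂ (λ x y → x + 2 * y) (F-even a) (F-odd b) ⟩
  3 * F a + 2 * (F (suc b) + 2 * F b)            ≡⟨ regroup₂ (F a) (F (suc b)) (F b) ⟩
  (F a + 2 * F (suc b)) + 2 * (F a + 2 * F b)    ≤⟨ shape-mono (ih (suc b) 1+b≤a) (ih b (<⇒≤ 1+b≤a)) ⟩
  F (a + suc b) + 2 * F (a + b)                  ≡⟨ cong (λ x → F x + 2 * F (a + b)) (+-suc a b) ⟩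
  F (suc (a + b)) + 2 * F (a + b)                ≡⟨ F-odd (a + b) ⟨
  F (suc ((a + b) + (a + b)))                    ≡⟨ cong F (interchange-suc a b) ⟨
  F ((a + a) + suc (b + b))                      ∎
  where
  open ≤-Reasoning
  regroup₂ : ∀ x y z → 3 * x + 2 * (y + 2 * z) ≡ (x + 2 * y) + 2 * (x + 2 * z)
  regroup₂ = solve-∀
  interchange-suc : ∀ m n → (m + m) + suc (n + n) ≡ suc ((m + n) + (m + n))
  interchange-suc = solve-∀

superadditive-odd : ∀ a → Superadditive a → Superadditive (suc a) → Superadditive (suc (a + a))
superadditive-odd a ih ih′ v v≤u with halve v
... | even b = let b≤a = even≤odd v≤u in begin
  F (suc (a + a)) + 2 * F (b + b)                ≡⟨ cong₂ (λ x y → x + 2 * y) (F-odd a) (F-even b) ⟩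
  (F (suc a) + 2 * F a) + 2 * (3 * F b)          ≡⟨ regroup₃ (F (suc a)) (F a) (F b) ⟩
  (F (suc a) + 2 * F b) + 2 * (F a + 2 * F b)    ≤⟨ shape-mono (ih′ b (m≤n⇒m≤1+n b≤a)) (ih b b≤a) ⟩
  F (suc (a + b)) + 2 * F (a + b)                ≡⟨ F-odd (a + b) ⟨
  F (suc ((a + b) + (a + b)))                    ≡⟨ cong (F ∘ suc) (interchange a b) ⟨
  F (suc (a + a) + (b + b))                      ∎
  where
  open ≤-Reasoning
  regroup₃ : ∀ w x y → (w + 2 * x) + 2 * (3 * y) ≡ (w + 2 * y) + 2 * (x + 2 * y)
  regroup₃ = solve-∀
  interchange : ∀ m n → (m + m) + (n + n) ≡ (m + n) + (m + n)
  interchange = solve-∀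
... | odd b = let b≤a = even≤even (≤-pred v≤u) in begin
  F (suc (a + a)) + 2 * F (suc (b + b))                ≡⟨ cong₂ (λ x y → x + 2 * y) (F-odd a) (F-odd b) ⟩
  (F (suc a) + 2 * F a) + 2 * (F (suc b) + 2 * F b)    ≡⟨ regroup₄ (F (suc a)) (F a) (F (suc b)) (F b) ⟩
  (F (suc a) + 2 * F b) + 2 * (F a + F (suc b) + F b)  ≤⟨ shape-mono (ih′ b (m≤n⇒m≤1+n b≤a)) (three b≤a) ⟩
  F (suc (a + b)) + 2 * F (suc (a + b))                ≡⟨ F-even (suc (a + b)) ⟨
  F (suc (a + b) + suc (a + b))                        ≡⟨ cong F (interchange-suc² a b) ⟨
  F (suc (a + a) + suc (b + b))                        ∎
  where
  open ≤-Reasoning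
  regroup₄ : ∀ w x y z → (w + 2 * x) + 2 * (y + 2 * z) ≡ (w + 2 * z) + 2 * (x + y + z)
  regroup₄ = solve-∀
  interchange-suc² : ∀ m n → suc (m + m) + suc (n + n) ≡ suc (m + n) + suc (m + n)
  interchange-suc² = solve-∀
  outer : ∀ x y → x + y + x ≡ y + 2 * x
  outer = solve-∀
  inner : ∀ x y → x + y + y ≡ x + 2 * y
  inner = solve-∀
  -- F a + F (b + 1) + F b ≤ F (a + b + 1): for b = a this is the odd
  -- recurrence, for b < a it follows from the hypothesis at (a, b + 1).
  three : b ≤ a → F a + F (suc b) + F b ≤ F (suc (a + b))
  three b≤a with m≤n⇒m<n∨m≡n b≤a
  ... | inj₂ refl = ≤-reflexive (begin-equality
    F b + F (suc b) + F b           ≡⟨ outer (F b) (F (suc b)) ⟩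
    F (suc b) + 2 * F b             ≡⟨ F-odd b ⟨
    F (suc (b + b))                 ∎)
  ... | inj₁ 1+b≤a = begin
    F a + F (suc b) + F b           ≤⟨ +-monoʳ-≤ (F a + F (suc b)) (F-suc-mono b) ⟩
    F a + F (suc b) + F (suc b)     ≡⟨ inner (F a) (F (suc b)) ⟩
    F a + 2 * F (suc b)             ≤⟨ ih (suc b) 1+b≤a ⟩
    F (a + suc b)                   ≡⟨ cong F (+-suc a b) ⟩
    F (suc (a + b))                 ∎

F-superadditive : ∀ u → Superadditive u
F-superadditive = halving-induction Superadditive base₀ base₁ superadditive-even superadditive-odd
  where
  base₀ : Superadditive 0
  base₀ zero z≤n = z≤n

  base₁ : Superadditive 1
  base₁ zero          _        = ≤-refl
  base₁ (suc zero)    _        = ≤-refl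
  base₁ (suc (suc v)) (s≤s ())

F-supermultiplicative : ∀ a b → F a * F b ≤ F (a * b)
F-supermultiplicative a = halving-induction (λ b → F a * F b ≤ F (a * b)) base₀ base₁ even-step odd-step
  where
  open ≤-Reasoning

  base₀ : F a * 0 ≤ F (a * 0)
  base₀ = subst (_≤ F (a * 0)) (sym (*-zeroʳ (F a))) z≤n

  base₁ : F a * 1 ≤ F (a * 1)
  base₁ = ≤-reflexive (trans (*-identityʳ (F a)) (cong F (sym (*-identityʳ a))))

  scale : ∀ x y → x * (3 * y) ≡ 3 * (x * y)
  scale = solve-∀
  spread : ∀ x y z → x * (y + 2 * z) ≡ x * y + 2 * (x * z)
  spread = solve-∀
  collect : ∀ m c → m * suc c + m * c ≡ m * suc (c + c)
  collect = solve-∀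

  even-step : ∀ c → F a * F c ≤ F (a * c) → F a * F (c + c) ≤ F (a * (c + c))
  even-step c ih = begin
    F a * F (c + c)          ≡⟨ cong (F a *_) (F-even c) ⟩
    F a * (3 * F c)          ≡⟨ scale (F a) (F c) ⟩
    3 * (F a * F c)          ≤⟨ *-monoʳ-≤ 3 ih ⟩
    3 * F (a * c)            ≡⟨ F-even (a * c) ⟨
    F (a * c + a * c)        ≡⟨ cong F (*-distribˡ-+ a c c) ⟨
    F (a * (c + c))          ∎

  odd-step : ∀ c → F a * F c ≤ F (a * c) → F a * F (suc c) ≤ F (a * suc c) →
             F a * F (suc (c + c)) ≤ F (a * suc (c + c))
  odd-step c ih ih′ = begin
    F a * F (suc (c + c))                  ≡⟨ cong (F a *_) (F-odd c) ⟩
    F a * (F (suc c) + 2 * F c)            ≡⟨ spread (F a) (F (suc c)) (F c) ⟩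
    F a * F (suc c) + 2 * (F a * F c)      ≤⟨ shape-mono ih′ ih ⟩
    F (a * suc c) + 2 * F (a * c)          ≤⟨ F-superadditive (a * suc c) (a * c) (*-monoʳ-≤ a (n≤1+n c)) ⟩
    F (a * suc c + a * c)                  ≡⟨ cong F (collect a c) ⟩
    F (a * suc (c + c))                    ∎

F-pow : ∀ N L → F N ^ L ≤ F (N ^ L)
F-pow N zero    = ≤-refl
F-pow N (suc L) = ≤-trans (*-monoʳ-≤ (F N) (F-pow N L)) (F-supermultiplicative N (N ^ L))

F-pow-two : ∀ k → F (2 ^ k) ≡ 3 ^ k
F-pow-two zero    = refl
F-pow-two (suc k) = begin
  F (2 ^ k + (2 ^ k + 0))    ≡⟨ cong (λ x → F (2 ^ k + x)) (+-identityʳ (2 ^ k)) ⟩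
  F (2 ^ k + 2 ^ k)          ≡⟨ F-even (2 ^ k) ⟩
  3 * F (2 ^ k)              ≡⟨ cong (3 *_) (F-pow-two k) ⟩
  3 * 3 ^ k                  ∎
  where open ≡-Reasoning

^-swap : ∀ m n o → (m ^ n) ^ o ≡ (m ^ o) ^ n
^-swap m n o = trans (^-*-assoc m n o) (trans (cong (m ^_) (*-comm n o)) (sym (^-*-assoc m o n)))

^-distribʳ-* : ∀ a b n → (a * b) ^ n ≡ a ^ n * b ^ n
^-distribʳ-* a b zero    = refl
^-distribʳ-* a b (suc n) = trans (cong (a * b *_) (^-distribʳ-* a b n)) (shuffle a b (a ^ n) (b ^ n))
  where
  shuffle : ∀ a b x y → a * b * (x * y) ≡ a * x * (b * y)
  shuffle = solve-∀

n≤2^n : ∀ n → n ≤ 2 ^ n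
n≤2^n zero    = z≤n
n≤2^n (suc n) = begin
  1 + n                  ≤⟨ +-mono-≤ (m^n>0 2 n) (n≤2^n n) ⟩
  2 ^ n + 2 ^ n          ≡⟨ cong (2 ^ n +_) (+-identityʳ (2 ^ n)) ⟨
  2 ^ n + (2 ^ n + 0)    ∎
  where open ≤-Reasoning

dyadic-window : ∀ M .{{_ : NonZero M}} → ∃[ j ] (M ≤ 2 ^ j × 2 ^ j ≤ 2 * M)
dyadic-window M = search M (n≤2^n M)
  where
  search : ∀ k → M ≤ 2 ^ k → ∃[ j ] (M ≤ 2 ^ j × 2 ^ j ≤ 2 * M)
  search zero    M≤1 = 0 , M≤1 , ≤-trans (>-nonZero⁻¹ M) (m≤m+n M (M + 0))
  search (suc k) M≤2ᵏ⁺¹ with M ≤? 2 ^ k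
  ... | yes M≤2ᵏ = search k M≤2ᵏ
  ... | no  M≰2ᵏ = suc k , M≤2ᵏ⁺¹ , *-monoʳ-≤ 2 (<⇒≤ (≰⇒> M≰2ᵏ))

bernoulli : ∀ w L → w ^ L * (w + L) ≤ w * suc w ^ L
bernoulli w zero    = ≤-reflexive (base w)
  where
  base : ∀ w → 1 * (w + 0) ≡ w * 1
  base = solve-∀
bernoulli w (suc L) = begin
  w * w ^ L * (w + suc L)                ≡⟨ expand w (w ^ L) L ⟩
  w ^ L * (w + L) * w + w ^ L * w        ≤⟨ +-monoʳ-≤ (w ^ L * (w + L) * w) (*-monoʳ-≤ (w ^ L) (m≤m+n w L)) ⟩
  w ^ L * (w + L) * w + w ^ L * (w + L)  ≡⟨ factor (w ^ L * (w + L)) w ⟩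
  w ^ L * (w + L) * suc w                ≤⟨ *-monoˡ-≤ (suc w) (bernoulli w L) ⟩
  w * suc w ^ L * suc w                  ≡⟨ *-assoc w (suc w ^ L) (suc w) ⟩
  w * (suc w ^ L * suc w)                ≡⟨ cong (w *_) (*-comm (suc w ^ L) (suc w)) ⟩
  w * (suc w * suc w ^ L)                ∎
  where
  open ≤-Reasoning
  expand : ∀ w x L → w * x * (w + suc L) ≡ x * (w + L) * w + x * w
  expand = solve-∀
  factor : ∀ y w → y * w + y ≡ y * suc w
  factor = solve-∀

-- The power trick: a bound xᴸ ≤ C yᴸ for every L forces x ≤ y, because
-- otherwise (1 + y)ᴸ ≤ C yᴸ for all L, contradicting Bernoulli at L = C y.
power-trick : ∀ {x y} C .{{_ : NonZero y}} → (∀ L → x ^ L ≤ C * y ^ L) → x ≤ y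
power-trick {x} {y} C bound with x ≤? y
... | yes x≤y = x≤y
... | no  x≰y = contradiction squeeze (<⇒≱ overshoot)
  where
  open ≤-Reasoning
  L : ℕ
  L = C * y
  squeeze : y ^ L * (y + L) ≤ y ^ L * L
  squeeze = begin
    y ^ L * (y + L)    ≤⟨ bernoulli y L ⟩
    y * suc y ^ L      ≤⟨ *-monoʳ-≤ y (^-monoˡ-≤ L (≰⇒> x≰y)) ⟩
    y * x ^ L          ≤⟨ *-monoʳ-≤ y (bound L) ⟩
    y * (C * y ^ L)    ≡⟨ rearrange y C (y ^ L) ⟩
    y ^ L * L          ∎
    where
    rearrange : ∀ y C z → y * (C * z) ≡ z * (C * y)
    rearrange = solve-∀
  overshoot : y ^ L * L < y ^ L * (y + L)
  overshoot = begin-strict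
    y ^ L * L              <⟨ m<n+m (y ^ L * L) (*-mono-≤ (m^n>0 y L) (>-nonZero⁻¹ y)) ⟩
    y ^ L * y + y ^ L * L  ≡⟨ *-distribˡ-+ (y ^ L) y L ⟨
    y ^ L * (y + L)        ∎

-- By supermultiplicativity F(N)ᴸ ≤ F(Nᴸ) ≤ F(2ʲ) = 3ʲ for the
-- dyadic 2ʲ ∈ [Nᴸ, 2Nᴸ]; this gives (F N ^ p)ᴸ ≤ 2^q (N ^ q)ᴸ for every L,
-- and the power trick removes the constant 2^q.
F-power-bound : ∀ N .{{_ : NonZero N}} p q → 3 ^ p ≤ 2 ^ q → F N ^ p ≤ N ^ q
F-power-bound N p q 3ᵖ≤2^q = power-trick (2 ^ q) {{m^n≢0 N q}} amplified
  where
  open ≤-Reasoning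
  amplified : ∀ L → (F N ^ p) ^ L ≤ 2 ^ q * (N ^ q) ^ L
  amplified L with dyadic-window (N ^ L) {{m^n≢0 N L}}
  ... | j , Nᴸ≤2ʲ , 2ʲ≤2Nᴸ = begin
    (F N ^ p) ^ L         ≡⟨ ^-swap (F N) p L ⟩
    (F N ^ L) ^ p         ≤⟨ ^-monoˡ-≤ p (F-pow N L) ⟩
    F (N ^ L) ^ p         ≤⟨ ^-monoˡ-≤ p (F-mono Nᴸ≤2ʲ) ⟩
    F (2 ^ j) ^ p         ≡⟨ cong (_^ p) (F-pow-two j) ⟩
    (3 ^ j) ^ p           ≡⟨ ^-swap 3 j p ⟩
    (3 ^ p) ^ j           ≤⟨ ^-monoˡ-≤ j 3ᵖ≤2^q ⟩
    (2 ^ q) ^ j           ≡⟨ ^-swap 2 q j ⟩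
    (2 ^ j) ^ q           ≤⟨ ^-monoˡ-≤ q 2ʲ≤2Nᴸ ⟩
    (2 * N ^ L) ^ q       ≡⟨ ^-distribʳ-* 2 (N ^ L) q ⟩
    2 ^ q * (N ^ L) ^ q   ≡⟨ cong (2 ^ q *_) (^-swap N L q) ⟩
    2 ^ q * (N ^ q) ^ L   ∎

count : ∀ {A : Set} → (A → Bool) → List A → ℕ
count R xs = length (filterᵇ R xs)

count-∷ : ∀ {A : Set} (R : A → Bool) x xs →
          count R (x ∷ xs) ≡ (if R x then suc (count R xs) else count R xs)
count-∷ R x xs with R x
... | true  = refl
... | false = refl

count-split : ∀ {n} (R : Assignment (suc n) → Bool) (as : List (Assignment n)) →
              count R (concatMap (λ a → (false ∷ a) ∷ (true ∷ a) ∷ []) as)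
              ≡ count (λ a → R (false ∷ a)) as + count (λ a → R (true ∷ a)) as
count-split R []       = refl
count-split R (a ∷ as)
  rewrite count-∷ R (false ∷ a) ((true ∷ a) ∷ concatMap (λ a → (false ∷ a) ∷ (true ∷ a) ∷ []) as)
        | count-∷ R (true ∷ a) (concatMap (λ a → (false ∷ a) ∷ (true ∷ a) ∷ []) as)
        | count-∷ (λ a → R (false ∷ a)) a as
        | count-∷ (λ a → R (true ∷ a)) a as
        | count-split R as
  with R (false ∷ a) | R (true ∷ a)
... | false | false = refl
... | true  | false = refl
... | false | true  = sym (+-suc _ _)
... | true  | true  = cong suc (sym (+-suc _ _))

_≟ₗ_ : (l s : Maybe Bool) → Dec (l ≡ s)
_≟ₗ_ = ≡-dec _≟ᵇ_

restrict : ∀ {n} → Maybe Bool → DNF (suc n) → DNF n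
restrict s []             = []
restrict s ((l ∷ t) ∷ D) = if does (l ≟ₗ s) then t ∷ restrict s D else restrict s D

restrict-All : ∀ {n} {P : Term (suc n) → Set} s (D : DNF (suc n)) →
               All P D → All (λ t → P (s ∷ t)) (restrict s D)
restrict-All s []            []       = []
restrict-All s ((l ∷ t) ∷ D) (p ∷ ps) with l ≟ₗ s
... | yes refl = p ∷ restrict-All s D ps
... | no  _    = restrict-All s D ps

restrict-Unique : ∀ {n} s (D : DNF (suc n)) → Unique D → Unique (restrict s D)
restrict-Unique s []            []           = []
restrict-Unique s ((l ∷ t) ∷ D) (t∉D ∷ uniq) with l ≟ₗ s
... | yes refl = all-map (λ t≢t′ t≡t′ → t≢t′ (cong (s ∷_) t≡t′)) (restrict-All s D t∉D)
                 ∷ restrict-Unique s D uniq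
... | no  _    = restrict-Unique s D uniq

restrict-length : ∀ {n} (D : DNF (suc n)) →
                  length D ≡ length (restrict nothing D) + length (restrict (just true) D)
                             + length (restrict (just false) D)
restrict-length []                     = refl
restrict-length ((nothing ∷ t) ∷ D)    = cong suc (restrict-length D)
restrict-length ((just true ∷ t) ∷ D)  =
  trans (cong suc (restrict-length D))
        (cong (_+ length (restrict (just false) D))
              (sym (+-suc (length (restrict nothing D)) (length (restrict (just true) D)))))
restrict-length ((just false ∷ t) ∷ D) =
  trans (cong suc (restrict-length D))
        (sym (+-suc (length (restrict nothing D) + length (restrict (just true) D))
                    (length (restrict (just false) D))))

Implies : ∀ {n} → (Assignment n → Bool) → Term n → Set
Implies R t = ∀ a → T (termTrue t a) → T (R a)

-- The inductive step of the counting argument: if the restrictions of D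
-- satisfy x ≤ F N₀, x ≤ F N₁ (terms free of the first variable), y ≤ F N₁
-- (positive literal) and z ≤ F N₀ (negative literal), then by
-- superadditivity x + y + z ≤ F (N₀ + N₁).
split-bound : ∀ {x y z} N₀ N₁ → x ≤ F N₀ → x ≤ F N₁ → y ≤ F N₁ → z ≤ F N₀ →
              x + y + z ≤ F (N₀ + N₁)
split-bound {x} {y} {z} N₀ N₁ x₀ x₁ y₁ z₀ with ≤-total N₀ N₁
... | inj₁ N₀≤N₁ = begin
  x + y + z             ≤⟨ +-mono-≤ (+-mono-≤ x₀ y₁) z₀ ⟩
  F N₀ + F N₁ + F N₀    ≡⟨ regroup (F N₀) (F N₁) ⟩
  F N₁ + 2 * F N₀       ≤⟨ F-superadditive N₁ N₀ N₀≤N₁ ⟩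
  F (N₁ + N₀)           ≡⟨ cong F (+-comm N₁ N₀) ⟩
  F (N₀ + N₁)           ∎
  where
  open ≤-Reasoning
  regroup : ∀ u v → u + v + u ≡ v + 2 * u
  regroup = solve-∀
... | inj₂ N₁≤N₀ = begin
  x + y + z             ≤⟨ +-mono-≤ (+-mono-≤ x₁ y₁) z₀ ⟩
  F N₁ + F N₁ + F N₀    ≡⟨ regroup (F N₀) (F N₁) ⟩
  F N₀ + 2 * F N₁       ≤⟨ F-superadditive N₀ N₁ N₁≤N₀ ⟩
  F (N₀ + N₁)           ∎
  where
  open ≤-Reasoning
  regroup : ∀ u v → v + v + u ≡ u + 2 * v
  regroup = solve-∀

terms-bound : ∀ n (D : DNF n) (R : Assignment n → Bool) → Unique D → All (Implies R) D →
              length D ≤ F (count R (allAssignments n))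
terms-bound zero []             R _ _ = z≤n
terms-bound zero ([] ∷ [])      R _ (R[] ∷ []) with R [] | R[] [] tt
... | true | _ = ≤-refl
terms-bound zero ([] ∷ [] ∷ _)  R ((distinct ∷ _) ∷ _) _ = ⊥-elim (distinct refl)
terms-bound (suc n) D R uniq implies = begin
  length D                                     ≡⟨ restrict-length D ⟩
  length D∅ + length D⁺ + length D⁻            ≤⟨ split-bound N₀ N₁ bound∅₀ bound∅₁ bound⁺ bound⁻ ⟩
  F (N₀ + N₁)                                  ≡⟨ cong F (count-split R (allAssignments n)) ⟨
  F (count R (allAssignments (suc n)))         ∎
  where
  open ≤-Reasoning
  R₀ R₁ : Assignment n → Bool
  R₀ a = R (false ∷ a)
  R₁ a = R (true ∷ a)
  N₀ N₁ : ℕ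
  N₀ = count R₀ (allAssignments n)
  N₁ = count R₁ (allAssignments n)
  D∅ D⁺ D⁻ : DNF n
  D∅ = restrict nothing D
  D⁺ = restrict (just true) D
  D⁻ = restrict (just false) D
  -- a term free of the first variable implies both R₀ and R₁; a term with
  -- literal x₁ implies R₁, one with literal ¬x₁ implies R₀
  bound∅₀ = terms-bound n D∅ R₀ (restrict-Unique nothing D uniq)
              (all-map (λ h a → h (false ∷ a)) (restrict-All nothing D implies))
  bound∅₁ = terms-bound n D∅ R₁ (restrict-Unique nothing D uniq)
              (all-map (λ h a → h (true ∷ a)) (restrict-All nothing D implies))
  bound⁺ = terms-bound n D⁺ R₁ (restrict-Unique (just true) D uniq)
              (all-map (λ h a → h (true ∷ a)) (restrict-All (just true) D implies))
  bound⁻ = terms-bound n D⁻ R₀ (restrict-Unique (just false) D uniq)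
              (all-map (λ h a → h (false ∷ a)) (restrict-All (just false) D implies))

terms-imply-models : ∀ {n} (D : DNF n) → All (Implies (isModel D)) D
terms-imply-models D = tabulate (λ t∈D a t-true → any⁺ (λ s → termTrue s a) (lose t∈D t-true))

power-transfer : ∀ {m} N p q → 0 < p → 3 ^ p ≤ 2 ^ q → m ≤ F N → m ^ p ≤ N ^ q
power-transfer zero    (suc p) q _ _ z≤n = z≤n
power-transfer (suc N) p       q _ 3ᵖ≤2^q m≤F = ≤-trans (^-monoˡ-≤ p m≤F) (F-power-bound (suc N) p q 3ᵖ≤2^q)

lemma8 : (n : ℕ) (D : DNF n) → All NonEmptyTerm D → Unique D →
         (p q : ℕ) → 0 < p → 3 ^ p ≤ 2 ^ q →
         length D ^ p ≤ numModels D ^ q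
lemma8 n D _ uniq p q 0<p 3ᵖ≤2^q =
  power-transfer (numModels D) p q 0<p 3ᵖ≤2^q (terms-bound n D (isModel D) uniq (terms-imply-models D))
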